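{- Let $D=(V,A)$ be a directed graph with nonnegative node costs $c$ and nonnegative node prizes $p$, let $B>0$, and suppose $D$ is $B$-proper for a node $r$. Let $T$ be an out-tree of $D$ rooted at $r$ with prize-to-cost ratio $\gamma=p(T)/c(T)$, and suppose that for some $\epsilon\in(0,1]$, $c(T)\ge\epsilon B/2$. Then one can find an out-tree $\hat T$ of $D$ rooted at $r$ with prize-to-cost ratio $p(\hat T)/c(\hat T)\ge\epsilon\gamma/4$ and $\epsilon B/2\le c(\hat T)\le(1+\epsilon)B$.
   Context: $c(T)=\sum_{v\in V(T)}c(v)$ and $p(T)=\sum_{v\in V(T)}p(v)$. The cost of a path is the sum of the costs of its nodes. $D$ is $B$-proper for $r$ if for every vertex $v$ there is a directed path from $r$ to $v$ of cost at most $B$.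
   Formalization: The node costs c, the node prizes p, the bound B and the parameter ε are rational rather than real. -}

module Defs where

open import Data.Nat using (ℕ; _<ᵇ_)
import Data.Nat as ℕ
open import Data.Bool using (Bool; true; false; T; if_then_else_)
open import Data.Fin using (Fin)
open import Data.List using (List; []; _∷_; map; foldr)
import Data.List as L
open import Data.List.Relation.Unary.Unique.Propositional using (Unique)
open import Data.Rational using (ℚ; 0ℚ; _+_; _≤_)
open import Data.Product using (Σ; _×_; ∃)
open import Relation.Binary.PropositionalEquality using (_≡_; _≢_)

sumℚ : List ℚ → ℚ
sumℚ = foldr _+_ 0ℚ

record Digraph : Set where
  field
    n   : ℕ
    arc : Fin n → Fin n → Bool

module _ (D : Digraph) where
  open Digraph D

  Arc : Fin n → Fin n → Set
  Arc u v = T (arc u v)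

  weightOf : (Fin n → ℚ) → (Fin n → Bool) → ℚ
  weightOf w S = sumℚ (map (λ v → if S v then w v else 0ℚ) (L.allFin n))

  data Walk : Fin n → Fin n → Set where
    here : ∀ {v} → Walk v v
    step : ∀ {u w v} → Arc u w → Walk w v → Walk u v

  walkNodes : ∀ {u v} → Walk u v → List (Fin n)
  walkNodes {u} here       = u ∷ []
  walkNodes {u} (step _ p) = u ∷ walkNodes p

  IsPath : ∀ {u v} → Walk u v → Set
  IsPath p = Unique (walkNodes p)

  pathCost : (Fin n → ℚ) → ∀ {u v} → Walk u v → ℚ
  pathCost c p = sumℚ (map c (walkNodes p))

  Proper : (Fin n → ℚ) → ℚ → Fin n → Set
  Proper c B r = ∀ v → Σ (Walk r v) λ p → IsPath p × pathCost c p ≤ B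

  -- An out-tree (arborescence) of D rooted at r: a vertex set containing r, where every
  -- non-root vertex v of the tree has a unique parent (the tail of its unique in-arc in the
  -- tree), which lies in the tree and such that (parent v , v) ∈ A; acyclicity is witnessed
  -- by a depth function strictly decreasing along parent links.  Tree arcs are exactly
  -- { (parent v , v) : v ∈ vertices , v ≠ r }.
  record OutTree (r : Fin n) : Set where
    field
      vertices   : Fin n → Bool
      root∈      : T (vertices r)
      parent     : Fin n → Fin n
      depth      : Fin n → ℕ
      parent∈    : ∀ v → T (vertices v) → v ≢ r → T (vertices (parent v))
      parentArc  : ∀ v → T (vertices v) → v ≢ r → Arc (parent v) v
      parentDeep : ∀ v → T (vertices v) → v ≢ r → depth (parent v) ℕ.< depth v

  treeWeight : ∀ {r} → (Fin n → ℚ) → OutTree r → ℚ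
  treeWeight w t = weightOf w (OutTree.vertices t)

{-# OPTIONS --safe #-}
module Submission where

-- Let L = εB/2 and γ = p(T)/c(T). If c(T) ≤ (1+ε)B, T itself will do. Otherwise T is cut down
-- to rooted subtrees S satisfying p(S) ≥ (3γ/4)(c(S) + L), which holds for T since c(T) ≥ 3L.
-- While c(S) > (1+ε)B, a deepest vertex w of S whose proper descendants cost at least L yields
-- a piece Q of S hanging from a single vertex a (one child subtree of w, or a union of light
-- child subtrees of w) with L ≤ c(Q) and c(Q - a) ≤ 2L. If p(Q) ≥ (3γ/4) c(Q), then Q joined to
-- a path from r to a of cost at most B will do; otherwise removing Q from S keeps the invariant.
-- Once c(S) ≤ (1+ε)B, S will do, after re-adding vertices of T (each of cost at most B) while
-- c(S) < L.

open import Defs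
open import Algebra.Bundles using (CommutativeMonoid)
import Algebra.Properties.CommutativeSemigroup as CommSemigroupProperties
open import Data.Bool using (Bool; true; false; T; not; _∧_; _∨_; if_then_else_)
open import Data.Bool.Properties using (T-∧; T-∨; T?)
open import Data.Empty using (⊥-elim)
open import Data.Fin using (Fin; zero; suc; _≟_)
open import Data.Fin.Properties using (any?; suc-injective)
open import Data.Integer using (+≤+)
open import Data.List using (List; []; _∷_; map; tabulate; allFin; filter)
open import Data.List.Extrema.Nat using (max; xs≤max; argmax; argmax-all; f[xs]≤f[argmax])
open import Data.List.Membership.Propositional using (_∈_)
open import Data.List.Membership.Propositional.Properties using (∈-allFin; ∈-map⁺; ∈-filter⁺)
open import Data.List.Properties using (map-cong; map-tabulate)
open import Data.List.Relation.Unary.All using (lookup)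
open import Data.List.Relation.Unary.All.Properties using (all-filter)
open import Data.List.Relation.Unary.Any using (here; there)
open import Data.Nat as ℕ using (ℕ; suc)
open import Data.Nat.Induction using (<-wellFounded)
import Data.Nat.Properties as ℕ
open import Data.Product using (Σ; ∃; _×_; _,_; proj₁; proj₂)
open import Data.Rational using (ℚ; 0ℚ; 1ℚ; ½; _+_; _*_; -_; _≤_; _<_; _≤?_; nonNegative; positive; *≤*)
open import Data.Rational.Properties hiding (_≟_)
open import Data.Rational.Solver using (module +-*-Solver)
open import Data.Sum using (_⊎_; inj₁; inj₂)
open import Function using (_∘_; id; flip; Equivalence)
open import Induction.WellFounded using (Acc; acc)
open import Relation.Binary.PropositionalEquality
open import Relation.Nullary using (¬_; Dec; yes; no; ¬?)
open import Relation.Nullary.Decidable using (⌊_⌋; toWitness; fromWitness; map′; _×-dec_)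

open CommSemigroupProperties (CommutativeMonoid.commutativeSemigroup +-0-commutativeMonoid)
  using () renaming (interchange to +-interchange)

+-cancelˡ-≤ : ∀ a {x y} → a + x ≤ a + y → x ≤ y
+-cancelˡ-≤ a {x} {y} a+x≤a+y = begin
  x              ≡⟨ cancel x ⟨
  - a + (a + x)  ≤⟨ +-monoʳ-≤ (- a) a+x≤a+y ⟩
  - a + (a + y)  ≡⟨ cancel y ⟩
  y              ∎
  where
  open ≤-Reasoning
  cancel : ∀ z → - a + (a + z) ≡ z
  cancel z = trans (sym (+-assoc (- a) a z)) (trans (cong (_+ z) (+-inverseˡ a)) (+-identityˡ z))

module _ {A : Set} where

  sumℚ-mono : ∀ {f g : A → ℚ} xs → (∀ x → f x ≤ g x) → sumℚ (map f xs) ≤ sumℚ (map g xs)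
  sumℚ-mono []       f≤g = ≤-refl
  sumℚ-mono (x ∷ xs) f≤g = +-mono-≤ (f≤g x) (sumℚ-mono xs f≤g)

  sumℚ-zero : ∀ {f : A → ℚ} xs → (∀ x → f x ≡ 0ℚ) → sumℚ (map f xs) ≡ 0ℚ
  sumℚ-zero []       f≡0 = refl
  sumℚ-zero (x ∷ xs) f≡0 = cong₂ _+_ (f≡0 x) (sumℚ-zero xs f≡0)

  sumℚ-+ : ∀ (f g : A → ℚ) xs → sumℚ (map (λ x → f x + g x) xs) ≡ sumℚ (map f xs) + sumℚ (map g xs)
  sumℚ-+ f g []       = refl
  sumℚ-+ f g (x ∷ xs) = trans (cong (f x + g x +_) (sumℚ-+ f g xs)) (+-interchange (f x) (g x) _ _)

sumℚ-tabulate-point : ∀ {m} (f : Fin m → ℚ) x → (∀ v → v ≢ x → f v ≡ 0ℚ) → sumℚ (tabulate f) ≡ f x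
sumℚ-tabulate-point {suc m} f zero f≡0 = begin
  f zero + sumℚ (tabulate (f ∘ suc)) ≡⟨ cong (f zero +_) (trans (cong sumℚ (sym (map-tabulate id (f ∘ suc))))
                                                  (sumℚ-zero (tabulate id) (λ v → f≡0 (suc v) λ ()))) ⟩
  f zero + 0ℚ                        ≡⟨ +-identityʳ (f zero) ⟩
  f zero                             ∎
  where open ≡-Reasoning
sumℚ-tabulate-point {suc m} f (suc x) f≡0 = trans
  (cong (_+ sumℚ (tabulate (f ∘ suc))) (f≡0 zero λ ()))
  (trans (+-identityˡ _) (sumℚ-tabulate-point (f ∘ suc) x λ v v≢x → f≡0 (suc v) (v≢x ∘ suc-injective)))

∧-intro : ∀ {a b} → T a → T b → T (a ∧ b)
∧-intro p q = Equivalence.from T-∧ (p , q)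

∧-elimˡ : ∀ {a b} → T (a ∧ b) → T a
∧-elimˡ = proj₁ ∘ Equivalence.to T-∧

∧-elimʳ : ∀ {a b} → T (a ∧ b) → T b
∧-elimʳ {a} = proj₂ ∘ Equivalence.to (T-∧ {a})

∨-introˡ : ∀ {a b} → T a → T (a ∨ b)
∨-introˡ = Equivalence.from T-∨ ∘ inj₁

∨-introʳ : ∀ {a b} → T b → T (a ∨ b)
∨-introʳ {a} = Equivalence.from (T-∨ {a}) ∘ inj₂

∨-elim : ∀ {a b} → T (a ∨ b) → T a ⊎ T b
∨-elim = Equivalence.to T-∨

not-intro : ∀ {a} → ¬ T a → T (not a)
not-intro {true}  ¬a = ¬a _
not-intro {false} ¬a = _

not-elim : ∀ {a} → T (not a) → ¬ T a
not-elim {true} () _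

module _ {A : Set} where

  count : (A → Bool) → List A → ℕ
  count P []       = 0
  count P (x ∷ xs) = (if P x then 1 else 0) ℕ.+ count P xs

  count-mono : ∀ {P Q : A → Bool} xs → (∀ x → T (P x) → T (Q x)) → count P xs ℕ.≤ count Q xs
  count-mono []       P⊆Q = ℕ.z≤n
  count-mono {P} {Q} (x ∷ xs) P⊆Q with P x | Q x | P⊆Q x
  ... | true  | true  | _   = ℕ.s≤s (count-mono xs P⊆Q)
  ... | true  | false | Qx  = ⊥-elim (Qx _)
  ... | false | true  | _   = ℕ.m≤n⇒m≤1+n (count-mono xs P⊆Q)
  ... | false | false | _   = count-mono xs P⊆Q

  count-mono-< : ∀ {P Q : A → Bool} {y} xs → (∀ x → T (P x) → T (Q x)) →
                 y ∈ xs → T (Q y) → ¬ T (P y) → count P xs ℕ.< count Q xs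
  count-mono-< {P} {Q} (x ∷ xs) P⊆Q (here refl) Qy ¬Py with P x | Q x
  ... | true  | _    = ⊥-elim (¬Py _)
  ... | false | true = ℕ.s≤s (count-mono xs P⊆Q)
  count-mono-< {P} {Q} (x ∷ xs) P⊆Q (there y∈xs) Qy ¬Py with P x | Q x | P⊆Q x
  ... | true  | true  | _  = ℕ.s≤s (count-mono-< xs P⊆Q y∈xs Qy ¬Py)
  ... | true  | false | Qx = ⊥-elim (Qx _)
  ... | false | true  | _  = ℕ.m≤n⇒m≤1+n (count-mono-< xs P⊆Q y∈xs Qy ¬Py)
  ... | false | false | _  = count-mono-< xs P⊆Q y∈xs Qy ¬Py

module VertexSets (D : Digraph) where
  open Digraph D

  VSet : Set
  VSet = Fin n → Bool

  _⊆_ : VSet → VSet → Set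
  A ⊆ B = ∀ v → T (A v) → T (B v)

  _∪_ _∖_ : VSet → VSet → VSet
  (A ∪ B) v = A v ∨ B v
  (A ∖ B) v = A v ∧ not (B v)

  ∅ : VSet
  ∅ _ = false

  ⁅_⁆ : Fin n → VSet
  ⁅ x ⁆ v = ⌊ v ≟ x ⌋

  x∈⁅x⁆ : ∀ x → T (⁅ x ⁆ x)
  x∈⁅x⁆ x = fromWitness {a? = x ≟ x} refl

  x∈⁅y⁆⇒x≡y : ∀ {x y} → T (⁅ y ⁆ x) → x ≡ y
  x∈⁅y⁆⇒x≡y {x} {y} = toWitness {a? = x ≟ y}

  ⊆-∪ˡ : ∀ A B → A ⊆ (A ∪ B)
  ⊆-∪ˡ A B v = ∨-introˡ

  ⊆-∪ʳ : ∀ A B → B ⊆ (A ∪ B)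
  ⊆-∪ʳ A B v = ∨-introʳ {A v}

  ∖⁺ : ∀ A B {v} → T (A v) → ¬ T (B v) → T ((A ∖ B) v)
  ∖⁺ A B v∈A v∉B = ∧-intro v∈A (not-intro v∉B)

  ∖⁻ : ∀ A B {v} → T ((A ∖ B) v) → T (A v) × ¬ T (B v)
  ∖⁻ A B {v} v∈ = ∧-elimˡ v∈ , not-elim (∧-elimʳ {A v} v∈)

  ∖-antitoneʳ : ∀ C {A B} → A ⊆ B → (C ∖ B) ⊆ (C ∖ A)
  ∖-antitoneʳ C {A} {B} A⊆B v v∈ = let v∈C , v∉B = ∖⁻ C B v∈ in ∖⁺ C A v∈C (v∉B ∘ A⊆B v)

  ⋃ : {I : Set} → (I → VSet) → List I → VSet
  ⋃ Y []       = ∅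
  ⋃ Y (i ∷ is) = Y i ∪ ⋃ Y is

  ∈⋃⁺ : ∀ {I} {Y : I → VSet} {i is v} → i ∈ is → T (Y i v) → T (⋃ Y is v)
  ∈⋃⁺         (here refl) v∈Yi = ∨-introˡ v∈Yi
  ∈⋃⁺ {Y = Y} {v = v} (there {x = j} i∈is) v∈Yi = ∨-introʳ {Y j v} (∈⋃⁺ i∈is v∈Yi)

  ∈⋃⁻ : ∀ {I} {Y : I → VSet} is {v} → T (⋃ Y is v) → ∃ λ i → i ∈ is × T (Y i v)
  ∈⋃⁻ {Y = Y} (i ∷ is) {v} v∈ with ∨-elim {Y i v} v∈
  ... | inj₁ v∈Yi = i , here refl , v∈Yi
  ... | inj₂ v∈⋃  = let j , j∈is , v∈Yj = ∈⋃⁻ is v∈⋃ in j , there j∈is , v∈Yj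

  x∉⁅y⁆⇒x≢y : ∀ {x y} → ¬ T (⁅ y ⁆ x) → x ≢ y
  x∉⁅y⁆⇒x≢y {x} x∉ refl = x∉ (x∈⁅x⁆ x)

  ∪-⊆-∪∖⁅⁆ : ∀ A B {x} → T (A x) → (A ∪ B) ⊆ (A ∪ (B ∖ ⁅ x ⁆))
  ∪-⊆-∪∖⁅⁆ A B {x} x∈A v v∈ with ∨-elim {A v} v∈ | T? (⁅ x ⁆ v)
  ... | inj₁ v∈A | _       = ⊆-∪ˡ A (B ∖ ⁅ x ⁆) v v∈A
  ... | inj₂ _   | yes v≡x = ⊆-∪ˡ A (B ∖ ⁅ x ⁆) v (subst (T ∘ A) (sym (x∈⁅y⁆⇒x≡y v≡x)) x∈A)
  ... | inj₂ v∈B | no  v≢x = ⊆-∪ʳ A (B ∖ ⁅ x ⁆) v (∖⁺ B ⁅ x ⁆ v∈B v≢x)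

  size : VSet → ℕ
  size A = count A (allFin n)

  size-mono-< : ∀ {A B} → A ⊆ B → ∀ {y} → T (B y) → ¬ T (A y) → size A ℕ.< size B
  size-mono-< A⊆B = count-mono-< (allFin n) A⊆B (∈-allFin _)

  W : (Fin n → ℚ) → VSet → ℚ
  W = weightOf D

  private
    restrict : VSet → (Fin n → ℚ) → Fin n → ℚ
    restrict A w v = if A v then w v else 0ℚ

  W-∅ : ∀ w → W w ∅ ≡ 0ℚ
  W-∅ w = sumℚ-zero (allFin n) (λ _ → refl)

  W-split : ∀ w {A B} → B ⊆ A → W w A ≡ W w B + W w (A ∖ B)
  W-split w {A} {B} B⊆A = trans (cong sumℚ (map-cong pointwise (allFin n))) (sumℚ-+ (restrict B w) (restrict (A ∖ B) w) (allFin n))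
    where
    pointwise : ∀ v → restrict A w v ≡ restrict B w v + restrict (A ∖ B) w v
    pointwise v with A v | B v | B⊆A v
    ... | true  | true  | _  = sym (+-identityʳ (w v))
    ... | true  | false | _  = sym (+-identityˡ (w v))
    ... | false | true  | Av = ⊥-elim (Av _)
    ... | false | false | _  = refl

  W-⁅⁆ : ∀ w x → W w ⁅ x ⁆ ≡ w x
  W-⁅⁆ w x = begin
    sumℚ (map (restrict ⁅ x ⁆ w) (tabulate id)) ≡⟨ cong sumℚ (map-tabulate id (restrict ⁅ x ⁆ w)) ⟩
    sumℚ (tabulate (restrict ⁅ x ⁆ w))          ≡⟨ sumℚ-tabulate-point _ x off-x ⟩
    restrict ⁅ x ⁆ w x                          ≡⟨ at-x ⟩
    w x                                         ∎
    where
    open ≡-Reasoning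
    off-x : ∀ v → v ≢ x → restrict ⁅ x ⁆ w v ≡ 0ℚ
    off-x v v≢x with v ≟ x
    ... | yes v≡x = ⊥-elim (v≢x v≡x)
    ... | no  _   = refl
    at-x : restrict ⁅ x ⁆ w x ≡ w x
    at-x with x ≟ x
    ... | yes _   = refl
    ... | no  x≢x = ⊥-elim (x≢x refl)

  module _ {w : Fin n → ℚ} (w≥0 : ∀ v → 0ℚ ≤ w v) where

    W-mono : ∀ {A B} → A ⊆ B → W w A ≤ W w B
    W-mono {A} {B} A⊆B = sumℚ-mono (allFin n) pointwise
      where
      pointwise : ∀ v → restrict A w v ≤ restrict B w v
      pointwise v with A v | B v | A⊆B v
      ... | true  | true  | _  = ≤-refl
      ... | true  | false | Bv = ⊥-elim (Bv _)
      ... | false | true  | _  = w≥0 v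
      ... | false | false | _  = ≤-refl

    W-∪ : ∀ A B → W w (A ∪ B) ≤ W w A + W w B
    W-∪ A B = ≤-trans (sumℚ-mono (allFin n) pointwise) (≤-reflexive (sumℚ-+ (restrict A w) (restrict B w) (allFin n)))
      where
      pointwise : ∀ v → restrict (A ∪ B) w v ≤ restrict A w v + restrict B w v
      pointwise v with A v | B v
      ... | true  | true  = ≤-trans (≤-reflexive (sym (+-identityʳ (w v)))) (+-monoʳ-≤ (w v) (w≥0 v))
      ... | true  | false = ≤-reflexive (sym (+-identityʳ (w v)))
      ... | false | true  = ≤-reflexive (sym (+-identityˡ (w v)))
      ... | false | false = ≤-refl

    W-nonNeg : ∀ A → 0ℚ ≤ W w A
    W-nonNeg A = subst (_≤ W w A) (W-∅ w) (W-mono λ _ ())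

    W-∋ : ∀ {A x} → T (A x) → w x ≤ W w A
    W-∋ {A} {x} x∈A = subst (_≤ W w A) (W-⁅⁆ w x) (W-mono ⁅x⁆⊆A)
      where
      ⁅x⁆⊆A : ⁅ x ⁆ ⊆ A
      ⁅x⁆⊆A v v≡x rewrite x∈⁅y⁆⇒x≡y v≡x = x∈A

    W-inhabited : ∀ A → 0ℚ < W w A → ∃ λ v → T (A v)
    W-inhabited A 0<W with any? (λ v → T? (A v))
    ... | yes inhabited = inhabited
    ... | no  empty     = ⊥-elim (<-irrefl refl (<-≤-trans 0<W (begin
      W w A  ≤⟨ W-mono (λ v v∈A → ⊥-elim (empty (v , v∈A))) ⟩
      W w ∅  ≡⟨ W-∅ w ⟩
      0ℚ     ∎)))
      where open ≤-Reasoning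

    -- Discrete intermediate value argument: dropping the first set lowers the weight by at most L.
    ⋃-suffix-in-window : ∀ {I} (Y : I → VSet) {L} → 0ℚ ≤ L →
                         (∀ i → W w (Y i) ≤ L) → ∀ is → L ≤ W w (⋃ Y is) →
                         ∃ λ js → L ≤ W w (⋃ Y js) × W w (⋃ Y js) ≤ L + L
    ⋃-suffix-in-window Y 0≤L Yi≤L [] L≤W = [] , L≤W , ≤-trans (≤-reflexive (W-∅ w)) (+-mono-≤ 0≤L 0≤L)
    ⋃-suffix-in-window Y {L} 0≤L Yi≤L (i ∷ is) L≤W with L ≤? W w (⋃ Y is)
    ... | yes L≤W′ = ⋃-suffix-in-window Y 0≤L Yi≤L is L≤W′
    ... | no  L≰W′ = i ∷ is , L≤W , ≤-trans (W-∪ (Y i) (⋃ Y is)) (+-mono-≤ (Yi≤L i) (<⇒≤ (≰⇒> L≰W′)))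

module WalkTrees (D : Digraph) where
  open Digraph D
  open VertexSets D

  walkTree : ∀ {u v} → Walk D u v → OutTree D u
  walkTree {u} here = record
    { vertices   = ⁅ u ⁆
    ; root∈      = x∈⁅x⁆ u
    ; parent     = id
    ; depth      = λ _ → 0
    ; parent∈    = λ _ x≡u x≢u → ⊥-elim (x≢u (x∈⁅y⁆⇒x≡y x≡u))
    ; parentArc  = λ _ x≡u x≢u → ⊥-elim (x≢u (x∈⁅y⁆⇒x≡y x≡u))
    ; parentDeep = λ _ x≡u x≢u → ⊥-elim (x≢u (x∈⁅y⁆⇒x≡y x≡u))
    }
  walkTree {u} (step {w = w} u→w p) = record
    { vertices   = vertices
    ; root∈      = ∨-introˡ (x∈⁅x⁆ u)
    ; parent     = parent
    ; depth      = depth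
    ; parent∈    = parent∈
    ; parentArc  = parentArc
    ; parentDeep = parentDeep
    }
    where
    module t = OutTree (walkTree p)

    vertices : VSet
    vertices = ⁅ u ⁆ ∪ t.vertices

    parent : Fin n → Fin n
    parent x with x ≟ w
    ... | yes _ = u
    ... | no  _ = t.parent x

    depth : Fin n → ℕ
    depth x with x ≟ u
    ... | yes _ = 0
    ... | no  _ = suc (t.depth x)

    in-rest : ∀ x → T (vertices x) → x ≢ u → T (t.vertices x)
    in-rest x x∈ x≢u with ∨-elim {⌊ x ≟ u ⌋} x∈
    ... | inj₁ x≡u = ⊥-elim (x≢u (x∈⁅y⁆⇒x≡y x≡u))
    ... | inj₂ x∈t = x∈t

    depth≤ : ∀ x → depth x ℕ.≤ suc (t.depth x)
    depth≤ x with x ≟ u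
    ... | yes _ = ℕ.z≤n
    ... | no  _ = ℕ.≤-refl

    parent∈ : ∀ x → T (vertices x) → x ≢ u → T (vertices (parent x))
    parent∈ x x∈ x≢u with x ≟ w
    ... | yes _   = ∨-introˡ (x∈⁅x⁆ u)
    ... | no  x≢w = ∨-introʳ (t.parent∈ x (in-rest x x∈ x≢u) x≢w)

    parentArc : ∀ x → T (vertices x) → x ≢ u → Arc D (parent x) x
    parentArc x x∈ x≢u with x ≟ w
    ... | yes refl = u→w
    ... | no  x≢w  = t.parentArc x (in-rest x x∈ x≢u) x≢w

    parentDeep : ∀ x → T (vertices x) → x ≢ u → depth (parent x) ℕ.< depth x
    parentDeep x x∈ x≢u with x ≟ u
    ... | yes x≡u = ⊥-elim (x≢u x≡u)
    ... | no  _ with x ≟ w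
    ...   | yes _ with u ≟ u
    ...     | yes _   = ℕ.s≤s ℕ.z≤n
    ...     | no  u≢u = ⊥-elim (u≢u refl)
    parentDeep x x∈t x≢u | no _ | no x≢w =
      ℕ.≤-<-trans (depth≤ (t.parent x)) (ℕ.s≤s (t.parentDeep x x∈t x≢w))

  walkTree-end : ∀ {u v} (p : Walk D u v) → T (OutTree.vertices (walkTree p) v)
  walkTree-end {u} here  = x∈⁅x⁆ u
  walkTree-end (step _ p) = ∨-introʳ (walkTree-end p)

  walkTree-cost : ∀ {c} → (∀ v → 0ℚ ≤ c v) → ∀ {u v} (p : Walk D u v) →
                  W c (OutTree.vertices (walkTree p)) ≤ pathCost D c p
  walkTree-cost {c} c≥0 {u} here       = ≤-reflexive (trans (W-⁅⁆ c u) (sym (+-identityʳ (c u))))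
  walkTree-cost {c} c≥0 {u} (step _ p) = begin
    W c (⁅ u ⁆ ∪ OutTree.vertices (walkTree p))       ≤⟨ W-∪ c≥0 ⁅ u ⁆ _ ⟩
    W c ⁅ u ⁆ + W c (OutTree.vertices (walkTree p))  ≤⟨ +-mono-≤ (≤-reflexive (W-⁅⁆ c u)) (walkTree-cost c≥0 p) ⟩
    c u + pathCost D c p                              ∎
    where open ≤-Reasoning

module Subtrees (D : Digraph) {r : Fin (Digraph.n D)} (Tr : OutTree D r) where
  open Digraph D
  open VertexSets D
  private
    module Tr = OutTree Tr
    Tv  = Tr.vertices
    par = Tr.parent
    dep = Tr.depth

  record Subtree (S : VSet) : Set where
    field
      root∈   : T (S r)
      ⊆tree   : S ⊆ Tv
      parent∈ : ∀ v → T (S v) → v ≢ r → T (S (par v))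

    outTree : OutTree D r
    outTree = record
      { vertices   = S
      ; root∈      = root∈
      ; parent     = par
      ; depth      = dep
      ; parent∈    = parent∈
      ; parentArc  = λ v v∈S → Tr.parentArc v (⊆tree v v∈S)
      ; parentDeep = λ v v∈S → Tr.parentDeep v (⊆tree v v∈S)
      }

  tree-Subtree : Subtree Tv
  tree-Subtree = record { root∈ = Tr.root∈ ; ⊆tree = λ _ v∈ → v∈ ; parent∈ = Tr.parent∈ }

  graft : (X : OutTree D r) (Q : VSet) → Q ⊆ Tv →
          (∀ q → T (Q q) → ¬ T (OutTree.vertices X q) → q ≢ r → T ((OutTree.vertices X ∪ Q) (par q))) →
          OutTree D r
  graft X Q Q⊆T hangs = record
    { vertices   = vertices
    ; root∈      = ∨-introˡ X.root∈
    ; parent     = parent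
    ; depth      = depth
    ; parent∈    = parent∈
    ; parentArc  = parentArc
    ; parentDeep = parentDeep
    }
    where
    module X = OutTree X

    vertices : VSet
    vertices = X.vertices ∪ Q

    K : ℕ
    K = suc (max 0 (map X.depth (allFin n)))

    X-depth<K : ∀ x → X.depth x ℕ.< K
    X-depth<K x = ℕ.s≤s (lookup (xs≤max 0 (map X.depth (allFin n))) (∈-map⁺ X.depth (∈-allFin x)))

    parent : Fin n → Fin n
    parent x with T? (X.vertices x)
    ... | yes _ = X.parent x
    ... | no  _ = par x

    depth : Fin n → ℕ
    depth x with T? (X.vertices x)
    ... | yes _ = X.depth x
    ... | no  _ = K ℕ.+ dep x

    depth-X : ∀ {x} → T (X.vertices x) → depth x ≡ X.depth x
    depth-X {x} x∈X with T? (X.vertices x)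
    ... | yes _   = refl
    ... | no  x∉X = ⊥-elim (x∉X x∈X)

    depth≤ : ∀ x → depth x ℕ.≤ K ℕ.+ dep x
    depth≤ x with T? (X.vertices x)
    ... | yes _ = ℕ.≤-trans (ℕ.<⇒≤ (X-depth<K x)) (ℕ.m≤m+n K (dep x))
    ... | no  _ = ℕ.≤-refl

    in-Q : ∀ x → T (vertices x) → ¬ T (X.vertices x) → T (Q x)
    in-Q x x∈ x∉X with ∨-elim {X.vertices x} x∈
    ... | inj₁ x∈X = ⊥-elim (x∉X x∈X)
    ... | inj₂ x∈Q = x∈Q

    parent∈ : ∀ x → T (vertices x) → x ≢ r → T (vertices (parent x))
    parent∈ x x∈ x≢r with T? (X.vertices x)
    ... | yes x∈X = ∨-introˡ (X.parent∈ x x∈X x≢r)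
    ... | no  x∉X = hangs x (in-Q x x∈ x∉X) x∉X x≢r

    parentArc : ∀ x → T (vertices x) → x ≢ r → Arc D (parent x) x
    parentArc x x∈ x≢r with T? (X.vertices x)
    ... | yes x∈X = X.parentArc x x∈X x≢r
    ... | no  x∉X = Tr.parentArc x (Q⊆T x (in-Q x x∈ x∉X)) x≢r

    parentDeep : ∀ x → T (vertices x) → x ≢ r → depth (parent x) ℕ.< depth x
    parentDeep x x∈ x≢r with T? (X.vertices x)
    ... | yes x∈X = subst (ℕ._< X.depth x) (sym (depth-X (X.parent∈ x x∈X x≢r))) (X.parentDeep x x∈X x≢r)
    ... | no  x∉X = ℕ.≤-<-trans (depth≤ (par x))
                      (ℕ.+-monoʳ-< K (Tr.parentDeep x (Q⊆T x (in-Q x x∈ x∉X)) x≢r))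

  module _ {S : VSet} (sS : Subtree S) where
    open Subtree sS

    ∪⁅⁆-Subtree : ∀ {u} → T (Tv u) → T (S (par u)) → Subtree (S ∪ ⁅ u ⁆)
    ∪⁅⁆-Subtree {u} u∈T pu∈S = record
      { root∈   = ∨-introˡ root∈
      ; ⊆tree   = ⊆tree′
      ; parent∈ = parent∈′
      }
      where
      ⊆tree′ : (S ∪ ⁅ u ⁆) ⊆ Tv
      ⊆tree′ x x∈ with ∨-elim {S x} x∈
      ... | inj₁ x∈S = ⊆tree x x∈S
      ... | inj₂ x≡u rewrite x∈⁅y⁆⇒x≡y x≡u = u∈T
      parent∈′ : ∀ x → T ((S ∪ ⁅ u ⁆) x) → x ≢ r → T ((S ∪ ⁅ u ⁆) (par x))
      parent∈′ x x∈ x≢r with ∨-elim {S x} x∈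
      ... | inj₁ x∈S = ∨-introˡ (parent∈ x x∈S x≢r)
      ... | inj₂ x≡u rewrite x∈⁅y⁆⇒x≡y x≡u = ∨-introˡ pu∈S

    ∖-Subtree : ∀ {Q} → ¬ T (Q r) → (∀ v → T (S v) → v ≢ r → T (Q (par v)) → T (Q v)) → Subtree (S ∖ Q)
    ∖-Subtree {Q} r∉Q downClosed = record
      { root∈   = ∖⁺ S Q root∈ r∉Q
      ; ⊆tree   = λ v → ⊆tree v ∘ proj₁ ∘ ∖⁻ S Q
      ; parent∈ = λ v v∈ v≢r → let v∈S , v∉Q = ∖⁻ S Q v∈ in
                    ∖⁺ S Q (parent∈ v v∈S v≢r) (v∉Q ∘ downClosed v v∈S v≢r)
      }

  data _≼_ (w : Fin n) : Fin n → Set where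
    ≼-refl  : w ≼ w
    ≼-child : ∀ {v} → T (Tv v) → v ≢ r → w ≼ par v → w ≼ v

  ≼-inv : ∀ {w v} → w ≼ v → v ≢ w → T (Tv v) × v ≢ r × w ≼ par v
  ≼-inv ≼-refl                    v≢w = ⊥-elim (v≢w refl)
  ≼-inv (≼-child v∈T v≢r w≼pv) _   = v∈T , v≢r , w≼pv

  ≼r⇒≡r : ∀ {w} → w ≼ r → w ≡ r
  ≼r⇒≡r ≼-refl              = refl
  ≼r⇒≡r (≼-child _ r≢r _)   = ⊥-elim (r≢r refl)

  r≼ : ∀ {v} → T (Tv v) → r ≼ v
  r≼ {v} v∈T = go v v∈T (<-wellFounded (dep v))
    where
    go : ∀ v → T (Tv v) → Acc ℕ._<_ (dep v) → r ≼ v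
    go v v∈T (acc rec) with v ≟ r
    ... | yes refl = ≼-refl
    ... | no  v≢r  = ≼-child v∈T v≢r
                       (go (par v) (Tr.parent∈ v v∈T v≢r) (rec (Tr.parentDeep v v∈T v≢r)))

  _≼?_ : ∀ w v → Dec (w ≼ v)
  w ≼? v = go v (<-wellFounded (dep v))
    where
    go : ∀ v → Acc ℕ._<_ (dep v) → Dec (w ≼ v)
    go v (acc rec) with v ≟ w
    ... | yes refl = yes ≼-refl
    ... | no  v≢w with T? (Tv v) | v ≟ r
    ...   | no  v∉T | _       = no (v∉T ∘ proj₁ ∘ flip ≼-inv v≢w)
    ...   | yes _   | yes v≡r = no (λ w≼v → proj₁ (proj₂ (≼-inv w≼v v≢w)) v≡r)
    ...   | yes v∈T | no  v≢r = map′ (≼-child v∈T v≢r) (proj₂ ∘ proj₂ ∘ flip ≼-inv v≢w)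
                                  (go (par v) (rec (Tr.parentDeep v v∈T v≢r)))

  ≼-closed : ∀ {S} → Subtree S → ∀ {w v} → w ≼ v → T (S v) → T (S w)
  ≼-closed sS ≼-refl                 v∈S = v∈S
  ≼-closed sS (≼-child _ v≢r w≼pv)   v∈S = ≼-closed sS w≼pv (Subtree.parent∈ sS _ v∈S v≢r)

  Child : Fin n → Fin n → Set
  Child w z = T (Tv z) × z ≢ r × par z ≡ w

  Child⇒deeper : ∀ {w z} → Child w z → dep w ℕ.< dep z
  Child⇒deeper (z∈T , z≢r , refl) = Tr.parentDeep _ z∈T z≢r

  ≼-cover : ∀ {w v} → w ≼ v → v ≢ w → ∃ λ z → Child w z × z ≼ v
  ≼-cover ≼-refl v≢w = ⊥-elim (v≢w refl)
  ≼-cover {w} (≼-child {v} v∈T v≢r w≼pv) _ with par v ≟ w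
  ... | yes pv≡w = v , (v∈T , v≢r , pv≡w) , ≼-refl
  ... | no  pv≢w with ≼-cover w≼pv pv≢w
  ...   | z , w→z , z≼pv = z , w→z , ≼-child v∈T v≢r z≼pv

  frontier : ∀ {S} → Subtree S → ∀ {v} → T (Tv v) → ¬ T (S v) →
             ∃ λ u → T (Tv u) × ¬ T (S u) × T (S (par u))
  frontier {S} sS v∈T = go (r≼ v∈T)
    where
    go : ∀ {v} → r ≼ v → ¬ T (S v) → ∃ λ u → T (Tv u) × ¬ T (S u) × T (S (par u))
    go ≼-refl r∉S = ⊥-elim (r∉S (Subtree.root∈ sS))
    go {v} (≼-child v∈T v≢r r≼pv) v∉S with T? (S (par v))
    ... | yes pv∈S = v , v∈T , v∉S , pv∈S
    ... | no  pv∉S = go r≼pv pv∉S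

  desc : VSet → Fin n → VSet
  desc S w v = ⌊ w ≼? v ⌋ ∧ S v

  desc⁺ : ∀ S {w v} → T (S v) → w ≼ v → T (desc S w v)
  desc⁺ S {w} {v} v∈S w≼v = ∧-intro (fromWitness {a? = w ≼? v} w≼v) v∈S

  desc⁻ : ∀ S w v → T (desc S w v) → T (S v) × w ≼ v
  desc⁻ S w v v∈ = ∧-elimʳ {⌊ w ≼? v ⌋} v∈ , toWitness {a? = w ≼? v} (∧-elimˡ v∈)

  module _ {S : VSet} (sS : Subtree S) where
    open Subtree sS

    desc-downClosed : ∀ {z} v → T (S v) → v ≢ r → T (desc S z (par v)) → T (desc S z v)
    desc-downClosed {z} v v∈S v≢r pv∈ = desc⁺ S v∈S (≼-child (⊆tree v v∈S) v≢r (proj₂ (desc⁻ S z (par v) pv∈)))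

    desc-hangs : ∀ {z v} → T (desc S z v) → v ≢ z → T (desc S z (par v))
    desc-hangs {z} {v} v∈ v≢z =
      let v∈S , z≼v = desc⁻ S z v v∈
          _ , v≢r , z≼pv = ≼-inv z≼v v≢z
      in desc⁺ S (parent∈ v v∈S v≢r) z≼pv

    r∉desc : ∀ {z} → z ≢ r → ¬ T (desc S z r)
    r∉desc {z} z≢r r∈ = z≢r (≼r⇒≡r (proj₂ (desc⁻ S z r r∈)))

module Growing (D : Digraph) {r : Fin (Digraph.n D)} (Tr : OutTree D r)
  {c : Fin (Digraph.n D) → ℚ} (c≥0 : ∀ v → 0ℚ ≤ c v) (L B : ℚ) (c≤B : ∀ v → c v ≤ B)
  (L≤cT : L ≤ treeWeight D c Tr) where
  open Digraph D
  open VertexSets D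
  open Subtrees D Tr
  private
    Tv = OutTree.vertices Tr

  grow : ∀ {S} → Subtree S → W c S < L →
         ∃ λ S′ → Subtree S′ × S ⊆ S′ × L ≤ W c S′ × W c S′ ≤ L + B
  grow sS = go sS (<-wellFounded _)
    where
    go : ∀ {S} → Subtree S → Acc ℕ._<_ (size (Tv ∖ S)) → W c S < L →
         ∃ λ S′ → Subtree S′ × S ⊆ S′ × L ≤ W c S′ × W c S′ ≤ L + B
    go {S} sS (acc rec) cS<L with any? (λ v → T? ((Tv ∖ S) v))
    ... | no Tv⊆S = ⊥-elim (<-irrefl refl (<-≤-trans cS<L (≤-trans L≤cT (W-mono c≥0 covered))))
      where
      covered : Tv ⊆ S
      covered v v∈T with T? (S v)
      ... | yes v∈S = v∈S
      ... | no  v∉S = ⊥-elim (Tv⊆S (v , ∖⁺ Tv S v∈T v∉S))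
    ... | yes (v , v∈T∖S) with frontier sS (proj₁ (∖⁻ Tv S v∈T∖S)) (proj₂ (∖⁻ Tv S v∈T∖S))
    ...   | u , u∈T , u∉S , pu∈S with L ≤? W c (S ∪ ⁅ u ⁆)
    ...     | yes L≤cS′ = S ∪ ⁅ u ⁆ , ∪⁅⁆-Subtree sS u∈T pu∈S , ⊆-∪ˡ S ⁅ u ⁆ , L≤cS′ , cS′≤L+B
      where
      cS′≤L+B : W c (S ∪ ⁅ u ⁆) ≤ L + B
      cS′≤L+B = begin
        W c (S ∪ ⁅ u ⁆)     ≤⟨ W-∪ c≥0 S ⁅ u ⁆ ⟩
        W c S + W c ⁅ u ⁆   ≡⟨ cong (W c S +_) (W-⁅⁆ c u) ⟩
        W c S + c u         ≤⟨ +-mono-≤ (<⇒≤ cS<L) (c≤B u) ⟩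
        L + B               ∎
        where open ≤-Reasoning
    ...     | no  L≰cS′ with go (∪⁅⁆-Subtree sS u∈T pu∈S) (rec fewer-missing) (≰⇒> L≰cS′)
      where
      fewer-missing : size (Tv ∖ (S ∪ ⁅ u ⁆)) ℕ.< size (Tv ∖ S)
      fewer-missing = size-mono-< (∖-antitoneʳ Tv (⊆-∪ˡ S ⁅ u ⁆)) (∖⁺ Tv S u∈T u∉S)
        (λ u∈ → proj₂ (∖⁻ Tv (S ∪ ⁅ u ⁆) u∈) (⊆-∪ʳ S ⁅ u ⁆ u (x∈⁅x⁆ u)))
    ...       | S′ , sS′ , S∪u⊆S′ , bounds = S′ , sS′ , (λ x → S∪u⊆S′ x ∘ ⊆-∪ˡ S ⁅ u ⁆ x) , bounds

module Pieces (D : Digraph) {r : Fin (Digraph.n D)} (Tr : OutTree D r)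
  {c : Fin (Digraph.n D) → ℚ} (c≥0 : ∀ v → 0ℚ ≤ c v) (L : ℚ) (0≤L : 0ℚ ≤ L) where
  open Digraph D
  open VertexSets D
  open Subtrees D Tr
  private
    Tv  = OutTree.vertices Tr
    par = OutTree.parent Tr
    dep = OutTree.depth Tr

    L≤L+L : L ≤ L + L
    L≤L+L = ≤-trans (≤-reflexive (sym (+-identityʳ L))) (+-monoʳ-≤ L 0≤L)

  -- A piece can be cut off S, and grafted onto any tree containing its apex.
  record Piece (S : VSet) : Set where
    field
      apex       : Fin n
      Q          : VSet
      Q⊆S        : Q ⊆ S
      r∉Q        : ¬ T (Q r)
      downClosed : ∀ v → T (S v) → v ≢ r → T (Q (par v)) → T (Q v)
      hangs      : ∀ v → T (Q v) → v ≢ apex → T (Q (par v)) ⊎ par v ≡ apex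
      heavy      : L ≤ W c Q
      light      : W c (Q ∖ ⁅ apex ⁆) ≤ L + L

  module _ {S : VSet} (sS : Subtree S) where
    open Subtree sS

    descPiece : ∀ {z} → z ≢ r → L ≤ W c (desc S z) → W c (desc S z ∖ ⁅ z ⁆) ≤ L + L → Piece S
    descPiece {z} z≢r heavy light = record
      { apex       = z
      ; Q          = desc S z
      ; Q⊆S        = λ v → proj₁ ∘ desc⁻ S z v
      ; r∉Q        = r∉desc sS z≢r
      ; downClosed = desc-downClosed sS
      ; hangs      = λ _ v∈ v≢z → inj₁ (desc-hangs sS v∈ v≢z)
      ; heavy      = heavy
      ; light      = light
      }

    module Children (w : Fin n) where

      ChildIn : Fin n → Set
      ChildIn z = T (S z) × Child w z

      childIn? : ∀ z → Dec (ChildIn z)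
      childIn? z = T? (S z) ×-dec T? (Tv z) ×-dec ¬? (z ≟ r) ×-dec (par z ≟ w)

      subtreesBelow : Fin n → VSet
      subtreesBelow z v = ⌊ childIn? z ⌋ ∧ desc S z v

      below⁺ : ∀ {z v} → ChildIn z → T (desc S z v) → T (subtreesBelow z v)
      below⁺ {z} z∈ = ∧-intro (fromWitness {a? = childIn? z} z∈)

      below⁻ : ∀ {z v} → T (subtreesBelow z v) → ChildIn z × T (desc S z v)
      below⁻ {z} v∈ = toWitness {a? = childIn? z} (∧-elimˡ v∈) , ∧-elimʳ {⌊ childIn? z ⌋} v∈

      below-light : (∀ z → ChildIn z → W c (desc S z) ≤ L) → ∀ z → W c (subtreesBelow z) ≤ L
      below-light light z with childIn? z
      ... | yes z∈ = light z z∈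
      ... | no  _  = ≤-trans (≤-reflexive (W-∅ c)) 0≤L

      below-cover : (desc S w ∖ ⁅ w ⁆) ⊆ ⋃ subtreesBelow (allFin n)
      below-cover v v∈ =
        let v∈desc , v∉w = ∖⁻ (desc S w) ⁅ w ⁆ v∈
            v∈S , w≼v = desc⁻ S w v v∈desc
            z , w→z , z≼v = ≼-cover w≼v (x∉⁅y⁆⇒x≢y v∉w)
        in ∈⋃⁺ (∈-allFin z) (below⁺ (≼-closed sS z≼v v∈S , w→z) (desc⁺ S v∈S z≼v))

      module _ (js : List (Fin n)) where

        ⋃below⊆S : ⋃ subtreesBelow js ⊆ S
        ⋃below⊆S v v∈ with ∈⋃⁻ js v∈
        ... | z , _ , v∈Yz = proj₁ (desc⁻ S z v (proj₂ (below⁻ v∈Yz)))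

        r∉⋃below : ¬ T (⋃ subtreesBelow js r)
        r∉⋃below r∈ with ∈⋃⁻ js r∈
        ... | z , _ , r∈Yz with below⁻ r∈Yz
        ...   | (_ , _ , z≢r , _) , r∈desc = r∉desc sS z≢r r∈desc

        ⋃below-downClosed : ∀ v → T (S v) → v ≢ r → T (⋃ subtreesBelow js (par v)) → T (⋃ subtreesBelow js v)
        ⋃below-downClosed v v∈S v≢r pv∈ with ∈⋃⁻ js pv∈
        ... | z , z∈js , pv∈Yz with below⁻ pv∈Yz
        ...   | z∈ , pv∈desc = ∈⋃⁺ z∈js (below⁺ z∈ (desc-downClosed sS v v∈S v≢r pv∈desc))

        ⋃below-hangs : ∀ v → T (⋃ subtreesBelow js v) → T (⋃ subtreesBelow js (par v)) ⊎ par v ≡ w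
        ⋃below-hangs v v∈ with ∈⋃⁻ js v∈
        ... | z , z∈js , v∈Yz with below⁻ v∈Yz | v ≟ z
        ...   | (_ , _ , _ , pz≡w) , _ | yes refl = inj₂ pz≡w
        ...   | z∈ , v∈desc           | no  v≢z  = inj₁ (∈⋃⁺ z∈js (below⁺ z∈ (desc-hangs sS v∈desc v≢z)))

      childrenPiece : (∀ z → ChildIn z → W c (desc S z) ≤ L) → L ≤ W c (desc S w ∖ ⁅ w ⁆) → Piece S
      childrenPiece light heavy
        with ⋃-suffix-in-window c≥0 subtreesBelow 0≤L (below-light light) (allFin n)
               (≤-trans heavy (W-mono c≥0 below-cover))
      ... | js , L≤W , W≤2L = record
        { apex       = w
        ; Q          = ⋃ subtreesBelow js
        ; Q⊆S        = ⋃below⊆S js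
        ; r∉Q        = r∉⋃below js
        ; downClosed = ⋃below-downClosed js
        ; hangs      = λ v v∈ _ → ⋃below-hangs js v v∈
        ; heavy      = L≤W
        ; light      = ≤-trans (W-mono c≥0 (λ v → proj₁ ∘ ∖⁻ (⋃ subtreesBelow js) ⁅ w ⁆ {v})) W≤2L
        }

    Heavy : Fin n → Set
    Heavy w = T (S w) × L ≤ W c (desc S w ∖ ⁅ w ⁆)

    heavy? : ∀ w → Dec (Heavy w)
    heavy? w = T? (S w) ×-dec (L ≤? W c (desc S w ∖ ⁅ w ⁆))

    deepestHeavy : Heavy r → ∃ λ w → Heavy w × (∀ z → Heavy z → dep z ℕ.≤ dep w)
    deepestHeavy Hr = w , argmax-all dep Hr (all-filter heavy? (allFin n)) , deepest
      where
      heavies = filter heavy? (allFin n)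
      w       = argmax dep r heavies
      deepest : ∀ z → Heavy z → dep z ℕ.≤ dep w
      deepest z Hz = lookup (f[xs]≤f[argmax] {f = dep} r heavies) (∈-filter⁺ heavy? (∈-allFin z) Hz)

    findPiece : L ≤ W c (S ∖ ⁅ r ⁆) → Piece S
    findPiece L≤cS-r with deepestHeavy (root∈ , ≤-trans L≤cS-r (W-mono c≥0 S-r⊆desc))
      where
      S-r⊆desc : (S ∖ ⁅ r ⁆) ⊆ (desc S r ∖ ⁅ r ⁆)
      S-r⊆desc v v∈ = let v∈S , v≢r = ∖⁻ S ⁅ r ⁆ v∈ in ∖⁺ (desc S r) ⁅ r ⁆ (desc⁺ S v∈S (r≼ (⊆tree v v∈S))) v≢r
    ... | w , Hw , deepest with any? (λ z → Children.childIn? w z ×-dec (L ≤? W c (desc S z)))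
    ...   | yes (z , z∈@(_ , _ , z≢r , _) , heavy) = descPiece z≢r heavy (≤-trans (<⇒≤ light) L≤L+L)
      where
      light : W c (desc S z ∖ ⁅ z ⁆) < L
      light = ≰⇒> (λ L≤ → ℕ.<⇒≱ (Child⇒deeper (proj₂ z∈)) (deepest z (proj₁ z∈ , L≤)))
    ...   | no  none = Children.childrenPiece w
                         (λ z z∈ → <⇒≤ (≰⇒> (λ L≤ → none (z , z∈ , L≤)))) (proj₂ Hw)

module Search (D : Digraph) (c p : Fin (Digraph.n D) → ℚ)
  (c≥0 : ∀ v → 0ℚ ≤ c v) (p≥0 : ∀ v → 0ℚ ≤ p v)
  (B : ℚ) (0<B : 0ℚ < B) (r : Fin (Digraph.n D)) (proper : Proper D c B r) (Tr : OutTree D r)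
  (ε : ℚ) (0<ε : 0ℚ < ε) (ε≤1 : ε ≤ 1ℚ) (L≤cT : ε * B * ½ ≤ treeWeight D c Tr) where
  open Digraph D
  open VertexSets D
  open WalkTrees D
  open Subtrees D Tr
  open +-*-Solver using (solve; _:=_; _:+_; _:*_; con)
  private
    Tv = OutTree.vertices Tr

  L three four cT pT : ℚ
  L     = ε * B * ½
  three = 1ℚ + 1ℚ + 1ℚ
  four  = 1ℚ + 1ℚ + 1ℚ + 1ℚ
  cT    = W c Tv
  pT    = W p Tv

  0<L : 0ℚ < L
  0<L = positive⁻¹ L {{pos*pos⇒pos (ε * B) {{pos*pos⇒pos ε {{positive 0<ε}} B {{positive 0<B}}}} ½}}

  0≤L : 0ℚ ≤ L
  0≤L = <⇒≤ 0<L

  L+L≡εB : L + L ≡ ε * B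
  L+L≡εB = trans (sym (*-distribˡ-+ (ε * B) ½ ½)) (*-identityʳ (ε * B))

  L≤εB : L ≤ ε * B
  L≤εB = ≤-trans (≤-reflexive (sym (+-identityʳ L))) (≤-trans (+-monoʳ-≤ L 0≤L) (≤-reflexive L+L≡εB))

  εx≤x : ∀ {x} → 0ℚ ≤ x → ε * x ≤ x
  εx≤x {x} 0≤x = ≤-trans (*-monoʳ-≤-nonNeg x {{nonNegative 0≤x}} ε≤1) (≤-reflexive (*-identityˡ x))

  [1+ε]B≡B+εB : (1ℚ + ε) * B ≡ B + ε * B
  [1+ε]B≡B+εB = trans (*-distribʳ-+ B 1ℚ ε) (cong (_+ ε * B) (*-identityˡ B))

  L+B≤[1+ε]B : L + B ≤ (1ℚ + ε) * B
  L+B≤[1+ε]B = ≤-trans (≤-reflexive (+-comm L B)) (≤-trans (+-monoʳ-≤ B L≤εB) (≤-reflexive (sym [1+ε]B≡B+εB)))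

  c≤B : ∀ v → c v ≤ B
  c≤B v with proper v
  ... | path , _ , cost≤B = ≤-trans (W-∋ c≥0 (walkTree-end path)) (≤-trans (walkTree-cost c≥0 path) cost≤B)

  1≤three : 1ℚ ≤ three
  1≤three = *≤* (+≤+ (ℕ.s≤s ℕ.z≤n))

  1≤four : 1ℚ ≤ four
  1≤four = *≤* (+≤+ (ℕ.s≤s ℕ.z≤n))

  0≤cT : 0ℚ ≤ cT
  0≤cT = W-nonNeg c≥0 Tv

  0≤pT : 0ℚ ≤ pT
  0≤pT = W-nonNeg p≥0 Tv

  -- With γ = pT / cT, Dense x y says that y / x ≥ 3γ/4, cleared of denominators.
  Dense : ℚ → ℚ → Set
  Dense x y = three * pT * x ≤ four * y * cT

  Invariant : VSet → Set
  Invariant S = Dense (W c S + L) (W p S)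

  Solution : OutTree D r → Set
  Solution X = let cX = W c (OutTree.vertices X) ; pX = W p (OutTree.vertices X) in
    (ε * pT * cX ≤ four * pX * cT) × (L ≤ cX) × (cX ≤ (1ℚ + ε) * B)

  dense⇒ratio : ∀ {x k y y′} → ε * x ≤ three * k → Dense k y → y ≤ y′ → ε * pT * x ≤ four * y′ * cT
  dense⇒ratio {x} {k} {y} {y′} εx≤3k dense y≤y′ = begin
    ε * pT * x        ≡⟨ solve 3 (λ e P X → e :* P :* X := P :* (e :* X)) refl ε pT x ⟩
    pT * (ε * x)      ≤⟨ *-monoˡ-≤-nonNeg pT {{nonNegative 0≤pT}} εx≤3k ⟩
    pT * (three * k)  ≡⟨ solve 3 (λ t P K → P :* (t :* K) := t :* P :* K) refl three pT k ⟩
    three * pT * k    ≤⟨ dense ⟩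
    four * y * cT     ≤⟨ *-monoʳ-≤-nonNeg cT {{nonNegative 0≤cT}} (*-monoˡ-≤-nonNeg four y≤y′) ⟩
    four * y′ * cT    ∎
    where open ≤-Reasoning

  dense-cancel : ∀ {a x b y} → Dense (a + x) (b + y) → four * b * cT ≤ three * pT * a → Dense x y
  dense-cancel {a} {x} {b} {y} dense sparse = +-cancelˡ-≤ (three * pT * a) (begin
    three * pT * a + three * pT * x  ≡⟨ *-distribˡ-+ (three * pT) a x ⟨
    three * pT * (a + x)             ≤⟨ dense ⟩
    four * (b + y) * cT              ≡⟨ solve 4 (λ f b y C → f :* (b :+ y) :* C := f :* b :* C :+ f :* y :* C) refl four b y cT ⟩
    four * b * cT + four * y * cT    ≤⟨ +-monoˡ-≤ (four * y * cT) sparse ⟩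
    three * pT * a + four * y * cT   ∎)
    where open ≤-Reasoning

  three*L≤[1+ε]B : three * L ≤ (1ℚ + ε) * B
  three*L≤[1+ε]B = begin
    three * L        ≡⟨ solve 1 (λ l → (o :+ o :+ o) :* l := l :+ (l :+ l)) refl L ⟩
    L + (L + L)      ≡⟨ cong (L +_) L+L≡εB ⟩
    L + ε * B        ≤⟨ +-monoˡ-≤ (ε * B) (≤-trans L≤εB (εx≤x (<⇒≤ 0<B))) ⟩
    B + ε * B        ≡⟨ [1+ε]B≡B+εB ⟨
    (1ℚ + ε) * B     ∎
    where open ≤-Reasoning; o = con 1ℚ

  tree-invariant : (1ℚ + ε) * B ≤ cT → Invariant Tv
  tree-invariant big = begin
    three * pT * (cT + L)            ≡⟨ solve 3 (λ t P C → t :* P :* C := P :* (t :* C)) refl three pT (cT + L) ⟩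
    pT * (three * (cT + L))          ≤⟨ *-monoˡ-≤-nonNeg pT {{nonNegative 0≤pT}} 3[cT+L]≤4cT ⟩
    pT * (four * cT)                 ≡⟨ solve 3 (λ f P C → P :* (f :* C) := f :* P :* C) refl four pT cT ⟩
    four * pT * cT                   ∎
    where
    open ≤-Reasoning
    o = con 1ℚ
    3[cT+L]≤4cT : three * (cT + L) ≤ four * cT
    3[cT+L]≤4cT = begin
      three * (cT + L)    ≡⟨ *-distribˡ-+ three cT L ⟩
      three * cT + three * L ≤⟨ +-monoʳ-≤ (three * cT) (≤-trans three*L≤[1+ε]B big) ⟩
      three * cT + cT     ≡⟨ solve 1 (λ C → (o :+ o :+ o) :* C :+ C := (o :+ o :+ o :+ o) :* C) refl cT ⟩
      four * cT           ∎

  tree-solution : cT ≤ (1ℚ + ε) * B → Solution Tr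
  tree-solution small = *-monoʳ-≤-nonNeg cT {{nonNegative 0≤cT}} (*-monoʳ-≤-nonNeg pT {{nonNegative 0≤pT}} (≤-trans ε≤1 1≤four))
                      , L≤cT , small

  open Growing D Tr c≥0 L B c≤B L≤cT
  open Pieces D Tr c≥0 L 0≤L

  invariant⇒solution : ∀ {S} → Subtree S → Invariant S → W c S ≤ (1ℚ + ε) * B → ∃ Solution
  invariant⇒solution {S} sS inv cS≤ with L ≤? W c S
  ... | yes L≤cS = Subtree.outTree sS , dense⇒ratio {y = W p S} {W p S} εcS≤ inv ≤-refl , L≤cS , cS≤
    where
    0≤cS = W-nonNeg c≥0 S
    εcS≤ : ε * W c S ≤ three * (W c S + L)
    εcS≤ = begin
      ε * W c S                 ≤⟨ εx≤x 0≤cS ⟩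
      W c S                     ≤⟨ ≤-trans (≤-reflexive (sym (+-identityʳ (W c S)))) (+-monoʳ-≤ (W c S) 0≤L) ⟩
      W c S + L                 ≤⟨ ≤-trans (≤-reflexive (sym (*-identityˡ (W c S + L))))
                                     (*-monoʳ-≤-nonNeg (W c S + L) {{nonNegative (+-mono-≤ 0≤cS 0≤L)}} 1≤three) ⟩
      three * (W c S + L)       ∎
      where open ≤-Reasoning
  ... | no L≰cS with grow sS (≰⇒> L≰cS)
  ...   | S′ , sS′ , S⊆S′ , L≤cS′ , cS′≤L+B =
          Subtree.outTree sS′ , dense⇒ratio {y = W p S} {W p S′} εcS′≤ inv (W-mono p≥0 S⊆S′) , L≤cS′ , ≤-trans cS′≤L+B L+B≤[1+ε]B
    where
    εcS′≤ : ε * W c S′ ≤ three * (W c S + L)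
    εcS′≤ = begin
      ε * W c S′                ≤⟨ *-monoˡ-≤-nonNeg ε {{nonNegative (<⇒≤ 0<ε)}} cS′≤L+B ⟩
      ε * (L + B)               ≡⟨ trans (*-distribˡ-+ ε L B) (cong (ε * L +_) (sym L+L≡εB)) ⟩
      ε * L + (L + L)           ≤⟨ +-monoˡ-≤ (L + L) (εx≤x 0≤L) ⟩
      L + (L + L)               ≡⟨ solve 1 (λ l → l :+ (l :+ l) := (o :+ o :+ o) :* l) refl L ⟩
      three * L                 ≤⟨ *-monoˡ-≤-nonNeg three (≤-trans (≤-reflexive (sym (+-identityˡ L))) (+-monoˡ-≤ L (W-nonNeg c≥0 S))) ⟩
      three * (W c S + L)       ∎
      where open ≤-Reasoning; o = con 1ℚ

  densePiece⇒solution : ∀ {S} → Subtree S → (P : Piece S) → Dense (W c (Piece.Q P)) (W p (Piece.Q P)) → ∃ Solution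
  densePiece⇒solution {S} sS P dense with proper (Piece.apex P)
  ... | path , _ , path≤B =
        X̂ , dense⇒ratio {y = W p Q} {W p (X ∪ Q)} εcX̂≤ dense (W-mono p≥0 (⊆-∪ʳ X Q))
          , ≤-trans heavy (W-mono c≥0 (⊆-∪ʳ X Q))
          , ≤-trans cX̂≤ (begin
              B + W c (Q ∖ ⁅ apex ⁆)  ≤⟨ +-monoʳ-≤ B light ⟩
              B + (L + L)             ≡⟨ trans (cong (B +_) L+L≡εB) (sym [1+ε]B≡B+εB) ⟩
              (1ℚ + ε) * B            ∎)
    where
    open Piece P
    open ≤-Reasoning

    X : VSet
    X = OutTree.vertices (walkTree path)

    apex∈X : T (X apex)
    apex∈X = walkTree-end path

    grafted : ∀ q → T (Q q) → ¬ T (X q) → q ≢ r → T ((X ∪ Q) (OutTree.parent Tr q))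
    grafted q q∈Q q∉X _ with hangs q q∈Q (λ { refl → q∉X apex∈X })
    ... | inj₁ pq∈Q = ⊆-∪ʳ X Q _ pq∈Q
    ... | inj₂ pq≡a = ⊆-∪ˡ X Q _ (subst (T ∘ X) (sym pq≡a) apex∈X)

    X̂ : OutTree D r
    X̂ = graft (walkTree path) Q (λ v → Subtree.⊆tree sS v ∘ Q⊆S v) grafted

    cX̂≤ : W c (X ∪ Q) ≤ B + W c (Q ∖ ⁅ apex ⁆)
    cX̂≤ = begin
      W c (X ∪ Q)                      ≤⟨ W-mono c≥0 (∪-⊆-∪∖⁅⁆ X Q apex∈X) ⟩
      W c (X ∪ (Q ∖ ⁅ apex ⁆))         ≤⟨ W-∪ c≥0 X (Q ∖ ⁅ apex ⁆) ⟩
      W c X + W c (Q ∖ ⁅ apex ⁆)       ≤⟨ +-monoˡ-≤ _ (≤-trans (walkTree-cost c≥0 path) path≤B) ⟩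
      B + W c (Q ∖ ⁅ apex ⁆)           ∎

    εcX̂≤ : ε * W c (X ∪ Q) ≤ three * W c Q
    εcX̂≤ = begin
      ε * W c (X ∪ Q)           ≤⟨ *-monoˡ-≤-nonNeg ε {{nonNegative (<⇒≤ 0<ε)}}
                                     (≤-trans cX̂≤ (+-monoʳ-≤ B (W-mono c≥0 (λ v → proj₁ ∘ ∖⁻ Q ⁅ apex ⁆ {v})))) ⟩
      ε * (B + W c Q)           ≡⟨ trans (*-distribˡ-+ ε B (W c Q)) (cong (_+ ε * W c Q) (sym L+L≡εB)) ⟩
      (L + L) + ε * W c Q       ≤⟨ +-mono-≤ (+-mono-≤ heavy heavy) (εx≤x (W-nonNeg c≥0 Q)) ⟩
      (W c Q + W c Q) + W c Q   ≡⟨ solve 1 (λ q → q :+ q :+ q := (o :+ o :+ o) :* q) refl (W c Q) ⟩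
      three * W c Q             ∎
      where o = con 1ℚ

  L≤cost-off-root : ∀ {S} → Subtree S → (1ℚ + ε) * B ≤ W c S → L ≤ W c (S ∖ ⁅ r ⁆)
  L≤cost-off-root {S} sS big = ≤-trans L≤εB (+-cancelˡ-≤ B (begin
    B + ε * B                      ≡⟨ [1+ε]B≡B+εB ⟨
    (1ℚ + ε) * B                   ≤⟨ big ⟩
    W c S                          ≡⟨ W-split c ⁅r⁆⊆S ⟩
    W c ⁅ r ⁆ + W c (S ∖ ⁅ r ⁆)    ≤⟨ +-monoˡ-≤ _ (≤-trans (≤-reflexive (W-⁅⁆ c r)) (c≤B r)) ⟩
    B + W c (S ∖ ⁅ r ⁆)            ∎))
    where
    open ≤-Reasoning
    ⁅r⁆⊆S : ⁅ r ⁆ ⊆ S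
    ⁅r⁆⊆S v v≡r rewrite x∈⁅y⁆⇒x≡y v≡r = Subtree.root∈ sS

  cutSparsePiece : ∀ {S} → Subtree S → Invariant S → (P : Piece S) → ¬ Dense (W c (Piece.Q P)) (W p (Piece.Q P)) →
        Subtree (S ∖ Piece.Q P) × Invariant (S ∖ Piece.Q P) × size (S ∖ Piece.Q P) ℕ.< size S
  cutSparsePiece {S} sS inv P sparse = ∖-Subtree sS r∉Q downClosed , inv′ , shrinks
    where
    open Piece P

    inv′ : Invariant (S ∖ Q)
    inv′ = dense-cancel {W c Q} {W c (S ∖ Q) + L} {W p Q} {W p (S ∖ Q)}
             (subst₂ Dense (trans (cong (_+ L) (W-split c Q⊆S)) (+-assoc (W c Q) (W c (S ∖ Q)) L)) (W-split p Q⊆S) inv)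
             (<⇒≤ (≰⇒> sparse))

    shrinks : size (S ∖ Q) ℕ.< size S
    shrinks with W-inhabited c≥0 Q (<-≤-trans 0<L heavy)
    ... | v , v∈Q = size-mono-< (λ u → proj₁ ∘ ∖⁻ S Q {u}) (Q⊆S v v∈Q) (λ v∈ → proj₂ (∖⁻ S Q v∈) v∈Q)

  search : ∀ {S} → Subtree S → Acc ℕ._<_ (size S) → Invariant S → ∃ Solution
  search {S} sS (acc rec) inv with W c S ≤? (1ℚ + ε) * B
  ... | yes cS≤ = invariant⇒solution sS inv cS≤
  ... | no  cS≰ = attachOrCut (findPiece sS (L≤cost-off-root sS (<⇒≤ (≰⇒> cS≰))))
    where
    attachOrCut : Piece S → ∃ Solution
    attachOrCut P with three * pT * W c (Piece.Q P) ≤? four * W p (Piece.Q P) * cT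
    ... | yes dense  = densePiece⇒solution sS P dense
    ... | no  sparse = let sS′ , inv′ , smaller = cutSparsePiece sS inv P sparse in search sS′ (rec smaller) inv′

lemma6 : (D : Digraph) (c p : Fin (Digraph.n D) → ℚ)
    → (∀ v → 0ℚ ≤ c v) → (∀ v → 0ℚ ≤ p v)
    → (B : ℚ) → 0ℚ < B
    → (r : Fin (Digraph.n D)) → Proper D c B r
    → (T : OutTree D r)
    → (ε : ℚ) → 0ℚ < ε → ε ≤ 1ℚ
    → ε * B * ½ ≤ treeWeight D c T
    → Σ (OutTree D r) λ T̂ →
        -- p(T̂)/c(T̂) ≥ ε γ / 4 with γ = p(T)/c(T), cleared of the (positive) denominators
        (ε * treeWeight D p T * treeWeight D c T̂ ≤ (1ℚ + 1ℚ + 1ℚ + 1ℚ) * treeWeight D p T̂ * treeWeight D c T)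
        × (ε * B * ½ ≤ treeWeight D c T̂)
        × (treeWeight D c T̂ ≤ (1ℚ + ε) * B)
lemma6 D c p c≥0 p≥0 B 0<B r proper T ε 0<ε ε≤1 L≤cT = solution
  where
  open Search D c p c≥0 p≥0 B 0<B r proper T ε 0<ε ε≤1 L≤cT
  open Subtrees D T using (tree-Subtree)

  solution : ∃ Solution
  solution with cT ≤? (1ℚ + ε) * B
  ... | yes small = T , tree-solution small
  ... | no  big   = search tree-Subtree (<-wellFounded _) (tree-invariant (<⇒≤ (≰⇒> big)))
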